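{- Let $n$ be a $2$-near perfect number with omitted divisors $d_1$ and $d_2$, and assume $n = 2^k p$ where $p$ is prime and $k$ is a positive integer. Then, after possibly interchanging $d_1$ and $d_2$, one of the following four situations holds: (1) $p = 2^k - 1$, with $d_1 = 1$ and $d_2 = p$; (2) $p = 2^{k+1} - 2^a - 2^b - 1$ for some natural numbers $a, b$, with $d_1 = 2^a$ and $d_2 = 2^b$; (3) $p = \dfrac{2^{k+1} - 2^a - 1}{1 + 2^b}$ for some natural numbers $a, b$, with $d_1 = 2^a$ and $d_2 = 2^b p$; (4) $p = \dfrac{2^{k+1} - 1}{1 + 2^a + 2^b}$ for some natural numbers $a, b$, with $d_1 = 2^a p$ and $d_2 = 2^b p$.
   Context: $\sigma(n)$ denotes the sum of the positive divisors of $n$. A positive integer $n$ is called $2$-near perfect if $\sigma(n) = 2n + d_1 + d_2$ for some two distinct positive divisors $d_1, d_2$ of $n$; these $d_1, d_2$ are called the omitted divisors. -}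

module Defs where

open import Data.Nat using (ℕ; suc; _+_; _*_)
open import Data.Nat.Divisibility using (_∣_; _∣?_)
open import Data.List using (List; filter; upTo; map)
open import Data.Nat.ListAction using (sum)
open import Data.Product using (_×_)
open import Relation.Binary.PropositionalEquality using (_≡_; _≢_)

divisors : ℕ → List ℕ
divisors n = filter (_∣? n) (map suc (upTo n))

σ : ℕ → ℕ
σ n = sum (divisors n)

TwoNearPerfectWith : ℕ → ℕ → ℕ → Set
TwoNearPerfectWith n d₁ d₂ =
  (0 Data.Nat.< n) × (0 Data.Nat.< d₁) × (0 Data.Nat.< d₂) ×
  (d₁ ∣ n) × (d₂ ∣ n) × (d₁ ≢ d₂) × (σ n ≡ 2 * n + d₁ + d₂)

{-# OPTIONS --safe #-}
module Submission where

-- The divisors of 2^k p, for an odd prime p, are the 2^a and the 2^a p with a ≤ k, all distinct,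
-- so σ(2^k p) = (2^(k+1) − 1)(p + 1). Comparing with σ(n) = 2^(k+1) p + d₁ + d₂ leaves
-- p + d₁ + d₂ + 1 = 2^(k+1), and each omitted divisor is of the form 2^a or 2^a p; the four
-- combinations give the four forms. For p = 2 the number n = 2^(k+1) is deficient, since
-- σ(2^m) = 2^(m+1) − 1, so it is not 2-near perfect at all.

open import Defs
open import Data.Nat using (ℕ; zero; suc; _<_; _≤_; _+_; _*_; _^_; z≤n; s≤s; _≟_; >-nonZero⁻¹)
open import Data.Nat.Properties
open import Data.Nat.Divisibility
open import Data.Nat.Primality using (Prime; prime[2]; prime⇒irreducible; prime⇒nonZero; ¬prime[1])
open import Data.Nat.Coprimality using (Coprime; coprime-divisor)
open import Data.Nat.ListAction using (sum)
open import Data.Nat.ListAction.Properties using (sum-++; sum-↭)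
open import Data.Nat.Tactic.RingSolver using (solve; solve-∀)
open import Data.List using (List; []; _∷_; _++_; map; downFrom; upTo)
open import Data.List.Membership.Propositional using (_∈_)
open import Data.List.Membership.Propositional.Properties
open import Data.List.Membership.Propositional.Properties.WithK using (unique∧set⇒bag)
open import Data.List.Relation.Binary.BagAndSetEquality using (∼bag⇒↭)
open import Data.List.Relation.Unary.Unique.Propositional using (Unique)
import Data.List.Relation.Unary.Unique.Propositional.Properties as Unique
open import Data.Product using (_×_; _,_; proj₂; ∃; ∃₂)
open import Data.Sum using (_⊎_; inj₁; inj₂)
open import Data.Empty using (⊥; ⊥-elim)
open import Function.Bundles using (mk⇔)
open import Relation.Nullary using (yes; no; ¬_)
open import Relation.Binary.Definitions using (tri<; tri≈; tri>)
open import Relation.Binary.PropositionalEquality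

private
  1<2 : 1 < 2
  1<2 = s≤s (s≤s z≤n)

powersOf2 : ℕ → List ℕ
powersOf2 m = map (2 ^_) (downFrom m)

sum-powersOf2 : ∀ m → sum (powersOf2 m) + 1 ≡ 2 ^ m
sum-powersOf2 zero    = refl
sum-powersOf2 (suc m) = begin
  2 ^ m + sum (powersOf2 m) + 1   ≡⟨ +-assoc (2 ^ m) _ 1 ⟩
  2 ^ m + (sum (powersOf2 m) + 1) ≡⟨ cong (2 ^ m +_) (sum-powersOf2 m) ⟩
  2 ^ m + 2 ^ m                   ≡⟨ cong (2 ^ m +_) (sym (+-identityʳ (2 ^ m))) ⟩
  2 ^ suc m                       ∎
  where open ≡-Reasoning

2^-injective : ∀ {a b} → 2 ^ a ≡ 2 ^ b → a ≡ b
2^-injective {a} {b} eq with <-cmp a b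
... | tri< a<b _ _ = ⊥-elim (<-irrefl eq (^-monoʳ-< 2 1<2 a<b))
... | tri≈ _ a≡b _ = a≡b
... | tri> _ _ a>b = ⊥-elim (<-irrefl (sym eq) (^-monoʳ-< 2 1<2 a>b))

powersOf2-unique : ∀ m → Unique (powersOf2 m)
powersOf2-unique m = Unique.map⁺ 2^-injective (Unique.downFrom⁺ m)

∈-powersOf2⁺ : ∀ {a m} → a < m → 2 ^ a ∈ powersOf2 m
∈-powersOf2⁺ a<m = ∈-map⁺ (2 ^_) (∈-downFrom⁺ a<m)

∈-powersOf2⁻ : ∀ {z m} → z ∈ powersOf2 m → ∃ λ a → a < m × z ≡ 2 ^ a
∈-powersOf2⁻ z∈ with a , a∈ , z≡2^a ← ∈-map⁻ (2 ^_) z∈ = a , ∈-downFrom⁻ a∈ , z≡2^a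

sum-map-* : ∀ p xs → sum (map (_* p) xs) ≡ sum xs * p
sum-map-* p []       = refl
sum-map-* p (x ∷ xs) = trans (cong (x * p +_) (sum-map-* p xs)) (sym (*-distribʳ-+ p x (sum xs)))

∈-divisors⁻ : ∀ {n z} → z ∈ divisors n → z ∣ n
∈-divisors⁻ {n} z∈ = proj₂ (∈-filter⁻ (_∣? n) {xs = map suc (upTo n)} z∈)

∈-divisors⁺ : ∀ {n z} → 0 < n → z ∣ n → z ∈ divisors n
∈-divisors⁺ {suc n} {zero}  _ 0∣n = ⊥-elim (1+n≢0 (0∣⇒≡0 0∣n))
∈-divisors⁺ {suc n} {suc z} _ z∣n = ∈-filter⁺ (_∣? suc n) (∈-map⁺ suc (∈-upTo⁺ (∣⇒≤ z∣n))) z∣n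

divisors-unique : ∀ n → Unique (divisors n)
divisors-unique n = Unique.filter⁺ (_∣? n) (Unique.map⁺ suc-injective (Unique.upTo⁺ n))

σ≡sum : ∀ {n} xs → 0 < n → Unique xs →
        (∀ {z} → z ∣ n → z ∈ xs) → (∀ {z} → z ∈ xs → z ∣ n) → σ n ≡ sum xs
σ≡sum {n} xs n>0 xs-unique complete sound =
  sum-↭ (∼bag⇒↭ (unique∧set⇒bag (divisors-unique n) xs-unique
    (mk⇔ (λ z∈ → complete (∈-divisors⁻ z∈)) (λ z∈ → ∈-divisors⁺ n>0 (sound z∈)))))

prime∤⇒coprime : ∀ {r d} → Prime r → ¬ r ∣ d → Coprime d r
prime∤⇒coprime pr r∤d (c∣d , c∣r) with prime⇒irreducible pr c∣r
... | inj₁ c≡1 = c≡1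
... | inj₂ refl = ⊥-elim (r∤d c∣d)

∣p^m*n⇒ : ∀ {r} → Prime r → ∀ m q d → d ∣ r ^ m * q →
          ∃ λ a → a ≤ m × ∃ λ e → e ∣ q × d ≡ r ^ a * e
∣p^m*n⇒ pr zero q d d∣q = 0 , z≤n , d , subst (d ∣_) (*-identityˡ q) d∣q , sym (*-identityˡ d)
∣p^m*n⇒ {r} pr (suc m) q d d∣ with r ∣? d
... | yes (divides d′ refl) with a , a≤m , e , e∣q , refl ← ∣p^m*n⇒ pr m q d′
      (*-cancelˡ-∣ r {{prime⇒nonZero pr}} (subst₂ _∣_ (*-comm d′ r) (*-assoc r (r ^ m) q) d∣))
  = suc a , s≤s a≤m , e , e∣q , trans (*-comm (r ^ a * e) r) (sym (*-assoc r (r ^ a) e))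
... | no r∤d with a , a≤m , rest ← ∣p^m*n⇒ pr m q d
      (coprime-divisor (prime∤⇒coprime pr r∤d) (subst (d ∣_) (*-assoc r (r ^ m) q) d∣))
  = a , m≤n⇒m≤1+n a≤m , rest

∣2^m⇒≡2^a : ∀ {m d} → d ∣ 2 ^ m → ∃ λ a → a ≤ m × d ≡ 2 ^ a
∣2^m⇒≡2^a {m} {d} d∣
  with a , a≤m , e , e∣1 , d≡ ← ∣p^m*n⇒ prime[2] m 1 d (subst (d ∣_) (sym (*-identityʳ (2 ^ m))) d∣)
  rewrite ∣1⇒≡1 e∣1 = a , a≤m , trans d≡ (*-identityʳ (2 ^ a))

m^a∣m^b : ∀ m {a b} → a ≤ b → m ^ a ∣ m ^ b
m^a∣m^b m {b = b} z≤n     = 1∣ (m ^ b)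
m^a∣m^b m         (s≤s a≤b) = *-monoʳ-∣ m (m^a∣m^b m a≤b)

σ[2^m] : ∀ m → σ (2 ^ m) ≡ sum (powersOf2 (suc m))
σ[2^m] m = σ≡sum (powersOf2 (suc m)) (m^n>0 2 m) (powersOf2-unique (suc m)) complete sound
  where
  complete : ∀ {z} → z ∣ 2 ^ m → z ∈ powersOf2 (suc m)
  complete z∣ with a , a≤m , refl ← ∣2^m⇒≡2^a {m} z∣ = ∈-powersOf2⁺ {m = suc m} (s≤s a≤m)
  sound : ∀ {z} → z ∈ powersOf2 (suc m) → z ∣ 2 ^ m
  sound z∈ with a , s≤s a≤m , refl ← ∈-powersOf2⁻ {m = suc m} z∈ = m^a∣m^b 2 a≤m

2^m-not-near-perfect : ∀ m d₁ d₂ → σ (2 ^ m) ≢ 2 * 2 ^ m + d₁ + d₂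
2^m-not-near-perfect m d₁ d₂ σ≡ = m+n+o+1≢m (2 * 2 ^ m) d₁ d₂ (begin
  2 * 2 ^ m + d₁ + d₂ + 1     ≡⟨ cong (_+ 1) σ≡ ⟨
  σ (2 ^ m) + 1               ≡⟨ cong (_+ 1) (σ[2^m] m) ⟩
  sum (powersOf2 (suc m)) + 1 ≡⟨ sum-powersOf2 (suc m) ⟩
  2 * 2 ^ m                   ∎)
  where
  open ≡-Reasoning
  m+n+o+1≢m : ∀ m n o → m + n + o + 1 ≢ m
  m+n+o+1≢m m n o eq = m≢1+m+n m (sym (trans (cong suc (sym (+-assoc m n o))) (trans (+-comm 1 _) eq)))

prime∣2^a⇒≡2 : ∀ {p a} → Prime p → p ∣ 2 ^ a → p ≡ 2
prime∣2^a⇒≡2 {a = a} pr p∣ with ∣2^m⇒≡2^a {a} p∣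
... | zero  , _ , refl = ⊥-elim (¬prime[1] pr)
... | suc c , _ , refl with prime⇒irreducible pr (m∣m*n (2 ^ c))
...   | inj₁ ()
...   | inj₂ 2≡p = sym 2≡p

2^a≢2^b*p : ∀ {p a b} → Prime p → p ≢ 2 → 2 ^ a ≢ 2 ^ b * p
2^a≢2^b*p {a = a} {b} pr p≢2 eq = p≢2 (prime∣2^a⇒≡2 {a = a} pr (subst (_ ∣_) (sym eq) (n∣m*n (2 ^ b))))

data DivisorOf2^k*p (k p : ℕ) : ℕ → Set where
  2^a   : ∀ {a} → a ≤ k → DivisorOf2^k*p k p (2 ^ a)
  2^a*p : ∀ {a} → a ≤ k → DivisorOf2^k*p k p (2 ^ a * p)

∣2^k*p⇒ : ∀ {k p d} → Prime p → d ∣ 2 ^ k * p → DivisorOf2^k*p k p d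
∣2^k*p⇒ {k} {p} {d} pr d∣ with a , a≤k , e , e∣p , refl ← ∣p^m*n⇒ prime[2] k p d d∣
  with prime⇒irreducible pr e∣p
... | inj₁ refl = subst (DivisorOf2^k*p k p) (sym (*-identityʳ (2 ^ a))) (2^a a≤k)
... | inj₂ refl = 2^a*p a≤k

divisorsOf2^k*p : ℕ → ℕ → List ℕ
divisorsOf2^k*p k p = powersOf2 (suc k) ++ map (_* p) (powersOf2 (suc k))

σ[2^k*p] : ∀ {k p} → Prime p → p ≢ 2 → σ (2 ^ k * p) ≡ sum (powersOf2 (suc k)) * (1 + p)
σ[2^k*p] {k} {p} pr p≢2 = begin
  σ (2 ^ k * p)                                 ≡⟨ σ≡sum (divisorsOf2^k*p k p) n>0 unique complete sound ⟩
  sum (divisorsOf2^k*p k p)                     ≡⟨ sum-++ (powersOf2 (suc k)) _ ⟩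
  S + sum (map (_* p) (powersOf2 (suc k)))      ≡⟨ cong (S +_) (sum-map-* p (powersOf2 (suc k))) ⟩
  S + S * p                                     ≡⟨ cong (_+ S * p) (sym (*-identityʳ S)) ⟩
  S * 1 + S * p                                 ≡⟨ sym (*-distribˡ-+ S 1 p) ⟩
  S * (1 + p)                                   ∎
  where
  open ≡-Reasoning
  instance _ = prime⇒nonZero pr
  S = sum (powersOf2 (suc k))
  n>0 : 0 < 2 ^ k * p
  n>0 = >-nonZero⁻¹ (2 ^ k * p) {{m*n≢0 (2 ^ k) p {{m^n≢0 2 k}}}}
  unique : Unique (divisorsOf2^k*p k p)
  unique = Unique.++⁺ (powersOf2-unique (suc k))
    (Unique.map⁺ (*-cancelʳ-≡ _ _ p) (powersOf2-unique (suc k))) disjoint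
    where
    disjoint : ∀ {v} → v ∈ powersOf2 (suc k) × v ∈ map (_* p) (powersOf2 (suc k)) → ⊥
    disjoint (v∈ , v∈*p) with w , w∈ , refl ← ∈-map⁻ (_* p) {xs = powersOf2 (suc k)} v∈*p
      with b , _ , refl ← ∈-powersOf2⁻ {m = suc k} w∈ | a , _ , v≡2^a ← ∈-powersOf2⁻ {m = suc k} v∈
      = 2^a≢2^b*p {a = a} {b} pr p≢2 (sym v≡2^a)
  complete : ∀ {z} → z ∣ 2 ^ k * p → z ∈ divisorsOf2^k*p k p
  complete z∣ with ∣2^k*p⇒ pr z∣
  ... | 2^a   a≤k = ∈-++⁺ˡ (∈-powersOf2⁺ {m = suc k} (s≤s a≤k))
  ... | 2^a*p a≤k = ∈-++⁺ʳ (powersOf2 (suc k)) (∈-map⁺ (_* p) (∈-powersOf2⁺ {m = suc k} (s≤s a≤k)))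
  sound : ∀ {z} → z ∈ divisorsOf2^k*p k p → z ∣ 2 ^ k * p
  sound z∈ with ∈-++⁻ (powersOf2 (suc k)) z∈
  ... | inj₁ z∈₁ with a , s≤s a≤k , refl ← ∈-powersOf2⁻ {m = suc k} z∈₁ = ∣-trans (m^a∣m^b 2 a≤k) (m∣m*n p)
  ... | inj₂ z∈₂ with w , w∈ , refl ← ∈-map⁻ (_* p) {xs = powersOf2 (suc k)} z∈₂
    with a , s≤s a≤k , refl ← ∈-powersOf2⁻ {m = suc k} w∈ = *-monoˡ-∣ p (m^a∣m^b 2 a≤k)

S*[1+p]≡[S+1]*p+x⇒S≡p+x : ∀ S p x → S * (1 + p) ≡ (S + 1) * p + x → S ≡ p + x
S*[1+p]≡[S+1]*p+x⇒S≡p+x S p x eq = +-cancelˡ-≡ (S * p) S (p + x) (begin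
  S * p + S         ≡⟨ solve (S ∷ p ∷ []) ⟩
  S * (1 + p)       ≡⟨ eq ⟩
  (S + 1) * p + x   ≡⟨ solve (S ∷ p ∷ x ∷ []) ⟩
  S * p + (p + x)   ∎)
  where open ≡-Reasoning

near-perfect-2^k*p⇒ : ∀ {k p d₁ d₂} → Prime p → p ≢ 2 →
  σ (2 ^ k * p) ≡ 2 * (2 ^ k * p) + d₁ + d₂ → p + d₁ + d₂ + 1 ≡ 2 ^ (k + 1)
near-perfect-2^k*p⇒ {k} {p} {d₁} {d₂} pr p≢2 σ≡ = begin
  p + d₁ + d₂ + 1   ≡⟨ cong (_+ 1) (+-assoc p d₁ d₂) ⟩
  p + (d₁ + d₂) + 1 ≡⟨ cong (_+ 1) S≡ ⟨
  S + 1             ≡⟨ sum-powersOf2 (suc k) ⟩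
  2 ^ suc k         ≡⟨ cong (2 ^_) (+-comm 1 k) ⟩
  2 ^ (k + 1)       ∎
  where
  open ≡-Reasoning
  S = sum (powersOf2 (suc k))
  S≡ : S ≡ p + (d₁ + d₂)
  S≡ = S*[1+p]≡[S+1]*p+x⇒S≡p+x S p (d₁ + d₂) (begin
    S * (1 + p)                 ≡⟨ σ[2^k*p] {k} pr p≢2 ⟨
    σ (2 ^ k * p)               ≡⟨ σ≡ ⟩
    2 * (2 ^ k * p) + d₁ + d₂   ≡⟨ +-assoc (2 * (2 ^ k * p)) d₁ d₂ ⟩
    2 * (2 ^ k * p) + (d₁ + d₂) ≡⟨ cong (_+ (d₁ + d₂)) (*-assoc 2 (2 ^ k) p) ⟨
    2 ^ suc k * p + (d₁ + d₂)   ≡⟨ cong (λ t → t * p + (d₁ + d₂)) (sum-powersOf2 (suc k)) ⟨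
    (S + 1) * p + (d₁ + d₂)     ∎)

OmittedDivisorForms : (k p e₁ e₂ : ℕ) → Set
OmittedDivisorForms k p e₁ e₂ =
  (p + 1 ≡ 2 ^ k × e₁ ≡ 1 × e₂ ≡ p)
  ⊎ (∃₂ λ a b → p + 2 ^ a + 2 ^ b + 1 ≡ 2 ^ (k + 1) × e₁ ≡ 2 ^ a × e₂ ≡ 2 ^ b)
  ⊎ (∃₂ λ a b → p * (1 + 2 ^ b) + 2 ^ a + 1 ≡ 2 ^ (k + 1) × e₁ ≡ 2 ^ a × e₂ ≡ 2 ^ b * p)
  ⊎ (∃₂ λ a b → p * (1 + 2 ^ a + 2 ^ b) + 1 ≡ 2 ^ (k + 1) × e₁ ≡ 2 ^ a * p × e₂ ≡ 2 ^ b * p)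

private
  p*[1+y]+x+1≡p+x+y*p+1 : ∀ p x y → p * (1 + y) + x + 1 ≡ p + x + y * p + 1
  p*[1+y]+x+1≡p+x+y*p+1 = solve-∀

  p*[1+x]+y+1≡p+x*p+y+1 : ∀ p x y → p * (1 + x) + y + 1 ≡ p + x * p + y + 1
  p*[1+x]+y+1≡p+x*p+y+1 = solve-∀

  p*[1+x+y]+1≡p+x*p+y*p+1 : ∀ p x y → p * (1 + x + y) + 1 ≡ p + x * p + y * p + 1
  p*[1+x+y]+1≡p+x*p+y*p+1 = solve-∀

-- Form (1) is the case a = b = 0 of form (3).
omitted-divisor-forms : ∀ {k p d₁ d₂} → p + d₁ + d₂ + 1 ≡ 2 ^ (k + 1) →
  DivisorOf2^k*p k p d₁ → DivisorOf2^k*p k p d₂ →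
  ∃₂ λ e₁ e₂ → ((e₁ ≡ d₁ × e₂ ≡ d₂) ⊎ (e₁ ≡ d₂ × e₂ ≡ d₁)) × OmittedDivisorForms k p e₁ e₂
omitted-divisor-forms eq (2^a {a} _) (2^a {b} _) =
  _ , _ , inj₁ (refl , refl) , inj₂ (inj₁ (a , b , eq , refl , refl))
omitted-divisor-forms {p = p} eq (2^a {a} _) (2^a*p {b} _) =
  _ , _ , inj₁ (refl , refl) , inj₂ (inj₂ (inj₁ (a , b , trans (p*[1+y]+x+1≡p+x+y*p+1 p (2 ^ a) (2 ^ b)) eq , refl , refl)))
omitted-divisor-forms {p = p} eq (2^a*p {a} _) (2^a {b} _) =
  _ , _ , inj₂ (refl , refl) , inj₂ (inj₂ (inj₁ (b , a , trans (p*[1+x]+y+1≡p+x*p+y+1 p (2 ^ a) (2 ^ b)) eq , refl , refl)))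
omitted-divisor-forms {p = p} eq (2^a*p {a} _) (2^a*p {b} _) =
  _ , _ , inj₁ (refl , refl) , inj₂ (inj₂ (inj₂ (a , b , trans (p*[1+x+y]+1≡p+x*p+y*p+1 p (2 ^ a) (2 ^ b)) eq , refl , refl)))

theorem1 : (n d₁ d₂ k p : ℕ) → 0 < k → Prime p → n ≡ 2 ^ k * p → TwoNearPerfectWith n d₁ d₂ →
    ∃₂ λ (e₁ e₂ : ℕ) → ((e₁ ≡ d₁ × e₂ ≡ d₂) ⊎ (e₁ ≡ d₂ × e₂ ≡ d₁)) ×
      ((p + 1 ≡ 2 ^ k × e₁ ≡ 1 × e₂ ≡ p)
      ⊎ (∃₂ λ a b → p + 2 ^ a + 2 ^ b + 1 ≡ 2 ^ (k + 1) × e₁ ≡ 2 ^ a × e₂ ≡ 2 ^ b)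
      ⊎ (∃₂ λ a b → p * (1 + 2 ^ b) + 2 ^ a + 1 ≡ 2 ^ (k + 1) × e₁ ≡ 2 ^ a × e₂ ≡ 2 ^ b * p)
      ⊎ (∃₂ λ a b → p * (1 + 2 ^ a + 2 ^ b) + 1 ≡ 2 ^ (k + 1) × e₁ ≡ 2 ^ a * p × e₂ ≡ 2 ^ b * p))
theorem1 n d₁ d₂ k p _ pr refl (_ , _ , _ , d₁∣n , d₂∣n , _ , σn≡) with p ≟ 2
... | yes refl = ⊥-elim (2^m-not-near-perfect (suc k) d₁ d₂
                   (subst (λ m → σ m ≡ 2 * m + d₁ + d₂) (*-comm (2 ^ k) 2) σn≡))
... | no p≢2   = omitted-divisor-forms (near-perfect-2^k*p⇒ {k} pr p≢2 σn≡)
                   (∣2^k*p⇒ {k} pr d₁∣n) (∣2^k*p⇒ {k} pr d₂∣n)
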